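{- Let $\tau$ be a similarity type and let $\mathfrak F_2=(X_2,I_2,Y_2,(S_\sigma)_{\sigma\in\tau})$ and $\mathfrak F_1=(X_1,I_1,Y_1,(R_\sigma)_{\sigma\in\tau})$ be polarities with relations, both satisfying axioms FAx1–FAx4 below. Let $\pi=(p,q):\mathfrak F_2\to\mathfrak F_1$ be a weak bounded morphism (conditions MAx1–MAx3 below). Fix $\sigma=(i_{n+1};i_1\cdots i_n)\in\tau$ and write $R=R_\sigma$, $S=S_\sigma$. If for every tuple $\vec u$ with $u_j\in Z^1_{i_j}$ it holds that $\pi^{ -1}(\overline\alpha_R(\Gamma\vec u))=\overline\alpha_S(\pi^{ -1}[\Gamma\vec u])$, then for every tuple $\vec F$ of Galois sets $F_j\in\mathcal G(Z^1_{i_j})$ it holds that $\pi^{ -1}(\overline\alpha_R(\vec F))=\overline\alpha_S(\pi^{ -1}[\vec F])$.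
   Context: A polarity is $(X,I,Y)$ with $X,Y$ nonempty, $I\subseteq X\times Y$; $x\perp y$ iff $(x,y)\notin I$. $U^{\perp}=\{y: x\perp y\ \forall x\in U\}$, ${}^{\perp}V=\{x: x\perp y\ \forall y\in V\}$; stable sets $A={}^\perp(A^\perp)\subseteq X$, co-stable $B=({}^\perp B)^\perp\subseteq Y$ (Galois sets), forming complete lattices $\mathcal G(X),\mathcal G(Y)$ under inclusion. Priming: $U'=U^\perp$ ($U\subseteq X$), $V'={}^\perp V$ ($V\subseteq Y$). Sorts $Z_1=X$, $Z_\partial=Y$ (for frame $\mathfrak F_m$ write $Z^m_1=X_m$, $Z^m_\partial=Y_m$); $\overline1=\partial,\overline\partial=1$; for points $u,w$ of different sorts $w|u$ means $w\perp u$ or $u\perp w$ as sorting dictates. Preorders: $x\le z$ iff $\{x\}^\perp\subseteq\{z\}^\perp$ on $X$, $y\le v$ iff ${}^\perp\{y\}\subseteq{}^\perp\{v\}$ on $Y$; $\Gamma u=\{w: u\le w\}$; $\Gamma\vec u=(\Gamma u_1,\ldots,\Gamma u_n)$; closed elements are the sets $\Gamma u$. A relation of sort type $\sigma=(i_{n+1};i_1\cdots i_n)$ is $R\subseteq Z_{i_{n+1}}\times\prod_j Z_{i_j}$; $R\vec u=\{w: wR\vec u\}$; Galois dual $R'$: $vR'\vec u$ iff $w|v$ for all $w\in R\vec u$. $\alpha_R(\vec W)=\bigcup\{R\vec w: w_j\in W_j\}$, $\overline\alpha_R(\vec F)=(\alpha_R(\vec F))''$. Axioms for a frame with relations $(R_\sigma)_{\sigma\in\tau}$: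 FAx1: the frame is separated (both preorders are partial orders). FAx2: every $R_\sigma\vec u$ is a closed element of $\mathcal G(Z_{i_{n+1}})$. FAx3: for each $w$, the relation $wR_\sigma$ is decreasing in every argument place (if $wR_\sigma\vec u[v]_k$ and $v'\le v$ then $wR_\sigma\vec u[v']_k$). FAx4: all sections $wR'_\sigma\vec u[\_]_k=\{v: wR'_\sigma\vec u[v]_k\}$ of the Galois dual relations are Galois sets. For $\pi=(p,q)$ with $p:X_2\to X_1$, $q:Y_2\to Y_1$, write $\pi(w)=p(w)$ or $q(w)$ and $\pi^{ -1}(W)=p^{ -1}(W)$ or $q^{ -1}(W)$ according to sort; $\pi^{ -1}[\vec F]=(\pi^{ -1}(F_1),\ldots,\pi^{ -1}(F_n))$. Weak bounded morphism: MAx1: $x'I_2y'\Rightarrow p(x')I_1q(y')$; MAx2: for all $x\in X_1,y'\in Y_2$, if $xI_1q(y')$ then there is $x'\in X_2$ with $x\le p(x')$ and $x'I_2y'$; MAx3: for all $x'\in X_2,y\in Y_1$, if $p(x')I_1y$ then there is $y'\in Y_2$ with $y\le q(y')$ and $x'I_2y'$. -}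

module Defs where

open import Level using (0ℓ)
open import Data.Nat using (ℕ)
open import Data.Fin using (Fin; _≟_)
open import Data.Product using (Σ; ∃; _×_; _,_)
open import Relation.Nullary using (¬_; yes; no)
open import Relation.Unary using (Pred; _⊆_; _≐_)
open import Relation.Binary.PropositionalEquality using (_≡_; refl)

data Sort : Set where
  one ∂ : Sort

flip : Sort → Sort
flip one = ∂
flip ∂   = one

-- A similarity type τ: a set of operation symbols σ, each with a sort type
-- σ = (out σ ; ins σ 0 ⋯ ins σ (n-1)), n = arity σ.
record SimType : Set₁ where
  field
    Op    : Set
    arity : Op → ℕ
    out   : Op → Sort
    ins   : (σ : Op) → Fin (arity σ) → Sort

-- A polarity (X, I, Y) with X, Y nonempty (witnessed by x₀, y₀).
record Polarity : Set₁ where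
  field
    X  : Set
    Y  : Set
    I  : X → Y → Set
    x₀ : X
    y₀ : Y

module PolarityOps (P : Polarity) where
  open Polarity P public

  _⊥_ : X → Y → Set
  x ⊥ y = ¬ I x y

  Z : Sort → Set
  Z one = X
  Z ∂   = Y

  bar : (s : Sort) → Z s → Z (flip s) → Set
  bar one x y = x ⊥ y
  bar ∂   y x = x ⊥ y

  prime : (s : Sort) → Pred (Z s) 0ℓ → Pred (Z (flip s)) 0ℓ
  prime s U v = ∀ w → U w → bar s w v

  cl : (s : Sort) → Pred (Z s) 0ℓ → Pred (Z s) 0ℓ
  cl one U = prime ∂ (prime one U)
  cl ∂   U = prime one (prime ∂ U)

  IsGalois : (s : Sort) → Pred (Z s) 0ℓ → Set
  IsGalois s A = A ≐ cl s A

  Le : (s : Sort) → Z s → Z s → Set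
  Le s u w = ∀ v → bar s u v → bar s w v

  Γ : (s : Sort) → Z s → Pred (Z s) 0ℓ
  Γ s u w = Le s u w

  IsClosed : (s : Sort) → Pred (Z s) 0ℓ → Set
  IsClosed s A = Σ (Z s) λ u → A ≐ Γ s u

record FrameRel (τ : SimType) : Set₁ where
  open SimType τ
  field
    pol : Polarity
  open PolarityOps pol
  field
    rel : (σ : Op) → Z (out σ) → ((j : Fin (arity σ)) → Z (ins σ j)) → Set

module FrameOps {τ : SimType} (𝔉 : FrameRel τ) where
  open SimType τ
  open FrameRel 𝔉 public
  open PolarityOps pol public

  Args : Op → Set
  Args σ = (j : Fin (arity σ)) → Z (ins σ j)

  upd : {σ : Op} → Args σ → (k : Fin (arity σ)) → Z (ins σ k) → Args σ
  upd u k v j with j ≟ k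
  ... | yes refl = v
  ... | no _     = u j

  relSet : (σ : Op) → Args σ → Pred (Z (out σ)) 0ℓ
  relSet σ u w = rel σ w u

  dual : (σ : Op) → Z (flip (out σ)) → Args σ → Set
  dual σ v u = ∀ w → rel σ w u → bar (out σ) w v

  α : (σ : Op) → ((j : Fin (arity σ)) → Pred (Z (ins σ j)) 0ℓ) → Pred (Z (out σ)) 0ℓ
  α σ W z = Σ (Args σ) λ w → ((j : Fin (arity σ)) → W j (w j)) × rel σ z w

  ᾱ : (σ : Op) → ((j : Fin (arity σ)) → Pred (Z (ins σ j)) 0ℓ) → Pred (Z (out σ)) 0ℓ
  ᾱ σ F = cl (out σ) (α σ F)

  Γ⃗ : (σ : Op) → Args σ → (j : Fin (arity σ)) → Pred (Z (ins σ j)) 0ℓ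
  Γ⃗ σ u j = Γ (ins σ j) (u j)

record FrameAxioms {τ : SimType} (𝔉 : FrameRel τ) : Set where
  open SimType τ
  open FrameOps 𝔉
  field
    FAx1 : (s : Sort) (u w : Z s) → Le s u w → Le s w u → u ≡ w
    FAx2 : (σ : Op) (u : Args σ) → IsClosed (out σ) (relSet σ u)
    FAx3 : (σ : Op) (w : Z (out σ)) (u : Args σ) (k : Fin (arity σ))
           (v v′ : Z (ins σ k)) →
           rel σ w (upd u k v) → Le (ins σ k) v′ v → rel σ w (upd u k v′)
    FAx4 : (σ : Op) (w : Z (flip (out σ))) (u : Args σ) (k : Fin (arity σ)) →
           IsGalois (ins σ k) (λ v → dual σ w (upd u k v))

record WeakBoundedMorphism {τ : SimType} (𝔉₂ 𝔉₁ : FrameRel τ) : Set where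
  module F₁ = FrameOps 𝔉₁
  module F₂ = FrameOps 𝔉₂
  field
    p : F₂.X → F₁.X
    q : F₂.Y → F₁.Y
    MAx1 : ∀ x′ y′ → F₂.I x′ y′ → F₁.I (p x′) (q y′)
    MAx2 : ∀ (x : F₁.X) (y′ : F₂.Y) → F₁.I x (q y′) →
           Σ F₂.X λ x′ → F₁.Le one x (p x′) × F₂.I x′ y′
    MAx3 : ∀ (x′ : F₂.X) (y : F₁.Y) → F₁.I (p x′) y →
           Σ F₂.Y λ y′ → F₁.Le ∂ y (q y′) × F₂.I x′ y′

  π : (s : Sort) → F₂.Z s → F₁.Z s
  π one = p
  π ∂   = q

  π⁻¹ : (s : Sort) → Pred (F₁.Z s) 0ℓ → Pred (F₂.Z s) 0ℓ
  π⁻¹ s W w = W (π s w)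

-- Galois sets are up-sets, so a Galois tuple F⃗ is the union of the closed
-- tuples Γ u⃗ with u⃗ ∈ F⃗, and α only sees such unions.  Inverse images under a
-- weak bounded morphism commute with the closure ′′ up to upward closure: MAx1
-- and MAx3 (resp. MAx2) give cl (π⁻¹ A) ⊆ π⁻¹ (cl A) ⊆ cl (π⁻¹ (↑ A)).  With
-- these two inclusions the hypothesis on closed tuples Γ u⃗ transfers to F⃗.
module Submission where

open import Defs
open import Data.Fin using (Fin)
open import Relation.Unary using (Pred; _≐_; _⊆_)
open import Level using (0ℓ)
open import Data.Product using (Σ; _×_; _,_; proj₁; proj₂)

module PolarityProperties (P : Polarity) where
  open PolarityOps P

  IsUpperSet : (s : Sort) → Pred (Z s) 0ℓ → Set
  IsUpperSet s A = ∀ {a b} → Le s a b → A a → A b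

  ↑ : (s : Sort) → Pred (Z s) 0ℓ → Pred (Z s) 0ℓ
  ↑ s A b = Σ (Z s) λ a → A a × Le s a b

  Le-refl : ∀ s {u : Z s} → Le s u u
  Le-refl s v u|v = u|v

  cl-monotonic : ∀ s {A B : Pred (Z s) 0ℓ} → A ⊆ B → cl s A ⊆ cl s B
  cl-monotonic one A⊆B a∈clA y B⊥y = a∈clA y (λ a a∈A → B⊥y a (A⊆B a∈A))
  cl-monotonic ∂   A⊆B b∈clA x x⊥B = b∈clA x (λ b b∈A → x⊥B b (A⊆B b∈A))

  cl-extensive : ∀ s {A : Pred (Z s) 0ℓ} → A ⊆ cl s A
  cl-extensive one {x = a} a∈A y A⊥y = A⊥y a a∈A
  cl-extensive ∂   {x = b} b∈A x x⊥A = x⊥A b b∈A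

  cl-idempotent : ∀ s {A : Pred (Z s) 0ℓ} → cl s (cl s A) ⊆ cl s A
  cl-idempotent one a∈clclA y A⊥y = a∈clclA y (λ a a∈clA → a∈clA y A⊥y)
  cl-idempotent ∂   b∈clclA x x⊥A = b∈clclA x (λ b b∈clA → b∈clA x x⊥A)

  cl-isUpperSet : ∀ s {A : Pred (Z s) 0ℓ} → IsUpperSet s (cl s A)
  cl-isUpperSet one a≤b a∈clA y A⊥y = a≤b y (a∈clA y A⊥y)
  cl-isUpperSet ∂   a≤b b∈clA x x⊥A = a≤b x (b∈clA x x⊥A)

  isGalois⇒isUpperSet : ∀ s {A : Pred (Z s) 0ℓ} → IsGalois s A → IsUpperSet s A
  isGalois⇒isUpperSet s (A⊆clA , clA⊆A) a≤b a∈A =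
    clA⊆A (cl-isUpperSet s a≤b (A⊆clA a∈A))

  Γ⊆upperSet : ∀ s {A : Pred (Z s) 0ℓ} {u} → IsUpperSet s A → A u → Γ s u ⊆ A
  Γ⊆upperSet s upper u∈A u≤w = upper u≤w u∈A

module FrameProperties {τ : SimType} (𝔉 : FrameRel τ) where
  open SimType τ
  open FrameOps 𝔉
  open PolarityProperties pol public

  α-monotonic : ∀ σ {V W} → (∀ j → V j ⊆ W j) → α σ V ⊆ α σ W
  α-monotonic σ V⊆W (w , w∈V , r) = w , (λ j → V⊆W j (w∈V j)) , r

  ᾱ-monotonic : ∀ σ {V W} → (∀ j → V j ⊆ W j) → ᾱ σ V ⊆ ᾱ σ W
  ᾱ-monotonic σ V⊆W = cl-monotonic (out σ) (α-monotonic σ V⊆W)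

module MorphismProperties {τ : SimType} {𝔉₂ 𝔉₁ : FrameRel τ}
                          (m : WeakBoundedMorphism 𝔉₂ 𝔉₁) where
  open SimType τ
  open WeakBoundedMorphism m
  module P₁ = FrameProperties 𝔉₁
  module P₂ = FrameProperties 𝔉₂

  cl-π⁻¹⊆π⁻¹-cl : ∀ s {A : Pred (F₁.Z s) 0ℓ} →
                  F₂.cl s (π⁻¹ s A) ⊆ π⁻¹ s (F₁.cl s A)
  cl-π⁻¹⊆π⁻¹-cl one {A} {x} x∈cl y A⊥y Ipx,y with MAx3 x y Ipx,y
  ... | y′ , y≤qy′ , Ix,y′ = x∈cl y′ π⁻¹A⊥y′ Ix,y′
    where
    π⁻¹A⊥y′ : ∀ a′ → A (p a′) → F₂._⊥_ a′ y′
    π⁻¹A⊥y′ a′ pa′∈A Ia′,y′ = y≤qy′ (p a′) (A⊥y (p a′) pa′∈A) (MAx1 a′ y′ Ia′,y′)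
  cl-π⁻¹⊆π⁻¹-cl ∂ {A} {y} y∈cl x x⊥A Ix,qy with MAx2 x y Ix,qy
  ... | x′ , x≤px′ , Ix′,y = y∈cl x′ x′⊥π⁻¹A Ix′,y
    where
    x′⊥π⁻¹A : ∀ b′ → A (q b′) → F₂._⊥_ x′ b′
    x′⊥π⁻¹A b′ qb′∈A Ix′,b′ = x≤px′ (q b′) (x⊥A (q b′) qb′∈A) (MAx1 x′ b′ Ix′,b′)

  π⁻¹-cl⊆cl-π⁻¹-↑ : ∀ s {A : Pred (F₁.Z s) 0ℓ} →
                    π⁻¹ s (F₁.cl s A) ⊆ F₂.cl s (π⁻¹ s (P₁.↑ s A))
  π⁻¹-cl⊆cl-π⁻¹-↑ one {A} {x} px∈cl y′ ↑A⊥y′ Ix,y′ =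
    px∈cl (q y′) A⊥qy′ (MAx1 x y′ Ix,y′)
    where
    A⊥qy′ : ∀ a → A a → F₁._⊥_ a (q y′)
    A⊥qy′ a a∈A Ia,qy′ with MAx2 a y′ Ia,qy′
    ... | x″ , a≤px″ , Ix″,y′ = ↑A⊥y′ x″ (a , a∈A , a≤px″) Ix″,y′
  π⁻¹-cl⊆cl-π⁻¹-↑ ∂ {A} {y} qy∈cl x′ x′⊥↑A Ix′,y =
    qy∈cl (p x′) px′⊥A (MAx1 x′ y Ix′,y)
    where
    px′⊥A : ∀ b → A b → F₁._⊥_ (p x′) b
    px′⊥A b b∈A Ipx′,b with MAx3 x′ b Ipx′,b
    ... | y″ , b≤qy″ , Ix′,y″ = x′⊥↑A y″ (b , b∈A , b≤qy″) Ix′,y″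

  Preservesᾱ : (σ : Op) → ((j : Fin (arity σ)) → Pred (F₁.Z (ins σ j)) 0ℓ) → Set
  Preservesᾱ σ W = π⁻¹ (out σ) (F₁.ᾱ σ W) ≐ F₂.ᾱ σ (λ j → π⁻¹ (ins σ j) (W j))

  module _ (σ : Op) (preservesᾱ-Γ⃗ : (u : F₁.Args σ) → Preservesᾱ σ (F₁.Γ⃗ σ u))
           (F : (j : Fin (arity σ)) → Pred (F₁.Z (ins σ j)) 0ℓ)
           (F-galois : (j : Fin (arity σ)) → F₁.IsGalois (ins σ j) (F j)) where

    private
      s : Sort
      s = out σ

      π⁻¹F : (j : Fin (arity σ)) → Pred (F₂.Z (ins σ j)) 0ℓ
      π⁻¹F j = π⁻¹ (ins σ j) (F j)

      Γ⃗⊆F : ∀ {u} → (∀ j → F j (u j)) → ∀ j → F₁.Γ⃗ σ u j ⊆ F j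
      Γ⃗⊆F u∈F j = P₁.Γ⊆upperSet (ins σ j)
                     (P₁.isGalois⇒isUpperSet (ins σ j) (F-galois j)) (u∈F j)

      π⁻¹-↑α⊆ᾱ-π⁻¹ : π⁻¹ s (P₁.↑ s (F₁.α σ F)) ⊆ F₂.ᾱ σ π⁻¹F
      π⁻¹-↑α⊆ᾱ-π⁻¹ {z} (a , (u , u∈F , a∈Ru) , a≤πz) =
        P₂.ᾱ-monotonic σ (λ j {w} → Γ⃗⊆F u∈F j {π (ins σ j) w})
          (proj₁ (preservesᾱ-Γ⃗ u) πz∈ᾱΓ⃗u)
        where
        πz∈ᾱΓ⃗u : F₁.ᾱ σ (F₁.Γ⃗ σ u) (π s z)
        πz∈ᾱΓ⃗u = P₁.cl-isUpperSet s a≤πz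
                    (P₁.cl-extensive s (u , (λ j → P₁.Le-refl (ins σ j)) , a∈Ru))

      α-π⁻¹⊆π⁻¹-ᾱ : F₂.α σ π⁻¹F ⊆ π⁻¹ s (F₁.ᾱ σ F)
      α-π⁻¹⊆π⁻¹-ᾱ {z} (w , πw∈F , z∈Sw) =
        P₁.ᾱ-monotonic σ (Γ⃗⊆F πw∈F) (proj₂ (preservesᾱ-Γ⃗ πw) z∈ᾱΓ⃗πw)
        where
        πw : F₁.Args σ
        πw j = π (ins σ j) (w j)

        z∈ᾱΓ⃗πw : F₂.ᾱ σ (λ j → π⁻¹ (ins σ j) (F₁.Γ⃗ σ πw j)) z
        z∈ᾱΓ⃗πw = P₂.cl-extensive s (w , (λ j → P₁.Le-refl (ins σ j)) , z∈Sw)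

    π⁻¹-ᾱ⊆ᾱ-π⁻¹ : π⁻¹ s (F₁.ᾱ σ F) ⊆ F₂.ᾱ σ π⁻¹F
    π⁻¹-ᾱ⊆ᾱ-π⁻¹ z∈ =
      P₂.cl-idempotent s (P₂.cl-monotonic s π⁻¹-↑α⊆ᾱ-π⁻¹ (π⁻¹-cl⊆cl-π⁻¹-↑ s z∈))

    ᾱ-π⁻¹⊆π⁻¹-ᾱ : F₂.ᾱ σ π⁻¹F ⊆ π⁻¹ s (F₁.ᾱ σ F)
    ᾱ-π⁻¹⊆π⁻¹-ᾱ z∈ =
      P₁.cl-idempotent s (cl-π⁻¹⊆π⁻¹-cl s (P₂.cl-monotonic s α-π⁻¹⊆π⁻¹-ᾱ z∈))

proposition3p23 :
    (τ : SimType) (𝔉₂ 𝔉₁ : FrameRel τ) →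
    FrameAxioms 𝔉₂ → FrameAxioms 𝔉₁ →
    (m : WeakBoundedMorphism 𝔉₂ 𝔉₁) →
    (σ : SimType.Op τ) →
    ((u : FrameOps.Args 𝔉₁ σ) →
      WeakBoundedMorphism.π⁻¹ m (SimType.out τ σ) (FrameOps.ᾱ 𝔉₁ σ (FrameOps.Γ⃗ 𝔉₁ σ u))
        ≐ FrameOps.ᾱ 𝔉₂ σ (λ j → WeakBoundedMorphism.π⁻¹ m (SimType.ins τ σ j) (FrameOps.Γ⃗ 𝔉₁ σ u j))) →
    (F : (j : Fin (SimType.arity τ σ)) → Pred (FrameOps.Z 𝔉₁ (SimType.ins τ σ j)) _) →
    ((j : Fin (SimType.arity τ σ)) → FrameOps.IsGalois 𝔉₁ (SimType.ins τ σ j) (F j)) →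
    WeakBoundedMorphism.π⁻¹ m (SimType.out τ σ) (FrameOps.ᾱ 𝔉₁ σ F)
      ≐ FrameOps.ᾱ 𝔉₂ σ (λ j → WeakBoundedMorphism.π⁻¹ m (SimType.ins τ σ j) (F j))
proposition3p23 τ 𝔉₂ 𝔉₁ _ _ m σ preservesᾱ-Γ⃗ F F-galois =
  π⁻¹-ᾱ⊆ᾱ-π⁻¹ σ preservesᾱ-Γ⃗ F F-galois , ᾱ-π⁻¹⊆π⁻¹-ᾱ σ preservesᾱ-Γ⃗ F F-galois
  where open MorphismProperties m
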